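{- Let $m,n$ be positive integers and let $g\in G(m,1,n)$ have canonical reduced word $[m_1^{a_1},n_1]\cdot[m_2^{a_2},n_2]\cdots[m_r^{a_r},n_r]$. Then $\pi(g)\in G(2,1,n)$ has canonical reduced word $[m_1,n_1]\cdot[m_2,n_2]\cdots[m_r,n_r]$.
   Context: Let $\omega=\exp(2\pi i/m)$. $G(m,1,n)$ is the group of $n\times n$ monomial matrices whose nonzero entries are $m$-th roots of unity. $[w;(a_1,\ldots,a_n)]$ denotes the monomial matrix whose unique nonzero entry in column $i$ is $\omega^{a_i}$ in row $w(i)$ ($w$ a permutation of $\{1,\ldots,n\}$). Generators: $s_0=[\mathrm{id};(1,0,\ldots,0)]$, $s_j=[(j\ j+1);(0,\ldots,0)]$ for $1\le j\le n-1$; for $m=2$ this is $B_n=G(2,1,n)$. Block notation: for $0<i\le j$ and $1\le\epsilon\le m-1$, $[i^\epsilon,j]=[i,j]=s_is_{i+1}\cdots s_j$; $[(-i)^\epsilon,j]=s_is_{i-1}\cdots s_1s_0^\epsilon s_1s_2\cdots s_j$; and for $k\ge 0$, $[0^\epsilon,k]=s_0^\epsilon s_1\cdots s_k$. Using the minimal-length left coset representatives of $G(m,1,k)/G(m,1,k-1)$ (namely $1$, $s_{k-1}$, $s_{k-2}s_{k-1},\ldots,s_{k-1}\cdots s_1$ and $s_{i}\cdots s_1s_0^\epsilon s_1\cdots s_{k-1}$, $0\le i\le k-1$, $1\le\epsilon\le m-1$), every $g\in G(m,1,n)$ has a unique canonical reduced word $[m_1^{a_1},n_1]\cdots[m_r^{a_r},n_r]$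 (a reduced expression) with $n>n_1>\cdots>n_r\ge 0$, $|m_i|\le n_i$ and $1\le a_i\le m-1$. For $m=2$ all exponents equal $1$ and blocks are written $[m_i,n_i]$. An entry is nontrivial if it is neither $0$ nor $1$; $\pi:G(m,1,n)\to G(2,1,n)$ replaces every nontrivial entry by $-1$. -}

module Defs where

open import Data.Nat using (ℕ; zero; suc; _<_; _≤_; _∸_; _+_; NonZero; _≟_; _<?_)
open import Data.Nat.DivMod using (_mod_)
open import Data.Integer using (ℤ; +_; -[1+_]; ∣_∣)
open import Data.Fin using (Fin; toℕ; fromℕ<; pred)
open import Data.Vec using (Vec; tabulate; lookup)
open import Data.List using (List; []; _∷_; _++_; map; foldr; replicate)
open import Data.Product using (_×_; _,_)
open import Data.Unit using (⊤)
open import Relation.Nullary using (yes; no)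
open import Relation.Binary.PropositionalEquality using (_≡_)

-- Elements of G(m,1,n) in the notation [w;(a_1,...,a_n)]:
-- column i (0-based Fin index) has the entry ω^(expo i) in row perm i.
-- Exponents are taken in Fin m (i.e. modulo m).

record Mon (m n : ℕ) : Set where
  constructor ⟦_⨾_⟧
  field
    perm : Vec (Fin n) n
    expo : Vec (Fin m) n
open Mon public

module _ {m n : ℕ} .{{_ : NonZero m}} where

  _+ₘ_ : Fin m → Fin m → Fin m
  a +ₘ b = (toℕ a + toℕ b) mod m

  _·_ : Mon m n → Mon m n → Mon m n
  ⟦ w ⨾ a ⟧ · ⟦ v ⨾ b ⟧ =
    ⟦ tabulate (λ i → lookup w (lookup v i))
    ⨾ tabulate (λ i → lookup a (lookup v i) +ₘ lookup b i) ⟧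

  idM : Mon m n
  idM = ⟦ tabulate (λ i → i) ⨾ tabulate (λ _ → 0 mod m) ⟧

  s₀ : Mon m n
  s₀ = ⟦ tabulate (λ i → i) ⨾ tabulate e ⟧
    where
    e : Fin n → Fin m
    e i with toℕ i ≟ 0
    ... | yes _ = 1 mod m
    ... | no  _ = 0 mod m

-- the transposition (j j+1) of {1,...,n}, i.e. swapping the 0-based
-- indices j-1 and j (used only for 1 ≤ j ≤ n-1)
transp : (n j : ℕ) → Fin n → Fin n
transp n j i with toℕ i ≟ j ∸ 1
... | yes _ with suc (toℕ i) <? n
...   | yes p = fromℕ< p
...   | no  _ = i
transp n j i | no _ with toℕ i ≟ j
...   | yes _ = pred i
...   | no  _ = i

gen : (m n : ℕ) .{{_ : NonZero m}} → ℕ → Mon m n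
gen m n zero    = s₀
gen m n (suc j) = ⟦ tabulate (transp n (suc j)) ⨾ tabulate (λ _ → 0 mod m) ⟧

evalGens : (m n : ℕ) .{{_ : NonZero m}} → List ℕ → Mon m n
evalGens m n ks = foldr (λ k g → gen m n k · g) idM ks

-- Blocks.  A block [μ^a, ν] is a triple (μ , a , ν) with μ ∈ ℤ.

Block : Set
Block = ℤ × ℕ × ℕ

range : ℕ → ℕ → List ℕ
range i zero    = []
range i (suc k) = i ∷ range (suc i) k

rangeFromTo : ℕ → ℕ → List ℕ
rangeFromTo i j = range i (suc j ∸ i)

downTo1 : ℕ → List ℕ
downTo1 zero    = []
downTo1 (suc i) = suc i ∷ downTo1 i

blockGens : Block → List ℕ
blockGens (+ zero    , ε , j) = replicate ε 0 ++ rangeFromTo 1 j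
blockGens (+ (suc i) , ε , j) = rangeFromTo (suc i) j
blockGens (-[1+ i ]  , ε , j) = downTo1 (suc i) ++ replicate ε 0 ++ rangeFromTo 1 j

wordGens : List Block → List ℕ
wordGens [] = []
wordGens (b ∷ bs) = blockGens b ++ wordGens bs

evalWord : (m n : ℕ) .{{_ : NonZero m}} → List Block → Mon m n
evalWord m n W = evalGens m n (wordGens W)

CanonicalForm : (m bound : ℕ) → List Block → Set
CanonicalForm m bound [] = ⊤
CanonicalForm m bound ((μ , a , ν) ∷ W) =
  ν < bound × ∣ μ ∣ ≤ ν × 1 ≤ a × a < m × CanonicalForm m ν W

IsCanonicalWordOf : (m n : ℕ) .{{_ : NonZero m}} → List Block → Mon m n → Set
IsCanonicalWordOf m n W g = CanonicalForm m n W × evalWord m n W ≡ g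

-- π : G(m,1,n) → G(2,1,n): nontrivial entries (ω^a, a ≢ 0) become -1
π : {m n : ℕ} → Mon m n → Mon 2 n
π ⟦ w ⨾ a ⟧ = ⟦ w ⨾ tabulate (λ i → f (lookup a i)) ⟧
  where
  f : {m : ℕ} → Fin m → Fin 2
  f x with toℕ x ≟ 0
  ... | yes _ = Fin.zero
  ... | no  _ = Fin.suc Fin.zero

eraseExp : Block → Block
eraseExp (μ , a , ν) = (μ , 1 , ν)

-- An element is read off column by column: its permutation ignores how often
-- s₀ occurs in a word, and the exponent in column x counts the s₀'s acting on
-- that column.  In a block [μ^a, ν] with μ ≤ 0 the factor s₁⋯s_ν brings the
-- (0-based) column ν to the front, where s₀^a acts on it, and no other column
-- meets an s₀; a block with μ > 0 contains no s₀.  In a canonical word all later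
-- blocks only involve generators s_k with k < ν, so they fix column ν and keep
-- the columns below ν below ν.  Hence column x carries the exponent a of the
-- block with n_i = x if there is one with μ ≤ 0, and 0 otherwise; since
-- 1 ≤ a < m, the entry is nontrivial exactly when the erased word puts the
-- exponent 1 in that column.
module Submission where

open import Defs
open import Data.Nat using (ℕ; zero; suc; _≤_; _<_; _+_; _*_; _∸_; _⊓_; NonZero; >-nonZero⁻¹; z≤n; s≤s; _≟_; _<?_; _%_)
open import Data.Nat.Properties
open import Data.Nat.DivMod using (_mod_; %-distribˡ-+; m<n⇒m%n≡m)
open import Data.Integer using (+_; -[1+_]; ∣_∣)
open import Data.Fin as Fin using (Fin; toℕ)
open import Data.Fin.Properties using (toℕ-fromℕ<; toℕ-injective; toℕ-inject₁)
open import Data.Vec as Vec using (Vec; tabulate; lookup)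
open import Data.Vec.Properties using (lookup∘tabulate; tabulate∘lookup; tabulate-cong)
open import Data.List using (List; []; _∷_; _++_; map; replicate)
open import Data.List.Relation.Unary.All as All using (All; []; _∷_)
open import Data.List.Relation.Unary.All.Properties using (++⁺; replicate⁺)
open import Data.Product using (_,_)
open import Data.Unit using (tt)
open import Function.Bundles using (_⇔_; mk⇔; Equivalence)
open import Function.Properties.Equivalence using () renaming (refl to ⇔-refl; trans to ⇔-trans)
open import Relation.Nullary using (yes; no; contradiction)
open import Function.Base using (case_of_)
open import Relation.Binary.PropositionalEquality
open ≡-Reasoning

toℕ-pred : ∀ {n} (i : Fin n) → toℕ (Fin.pred i) ≡ toℕ i ∸ 1
toℕ-pred Fin.zero    = refl
toℕ-pred (Fin.suc i) = toℕ-inject₁ i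

toℕ-mod : ∀ k m .{{_ : NonZero m}} → toℕ (k mod m) ≡ k % m
toℕ-mod k m = toℕ-fromℕ< _

lookup-extensionality : ∀ {A : Set} {k} {u v : Vec A k} → (∀ i → lookup u i ≡ lookup v i) → u ≡ v
lookup-extensionality {u = u} {v} u≗v =
  trans (sym (tabulate∘lookup u)) (trans (tabulate-cong u≗v) (tabulate∘lookup v))

δ : ℕ → ℕ → ℕ
δ x y with x ≟ y
... | yes _ = 1
... | no _  = 0

δ-≢ : ∀ {x y} → x ≢ y → δ x y ≡ 0
δ-≢ {x} {y} x≢y with x ≟ y
... | yes x≡y = contradiction x≡y x≢y
... | no _    = refl

δ-refl : ∀ x → δ x x ≡ 1
δ-refl x with x ≟ x
... | yes _   = refl
... | no x≢x  = contradiction refl x≢x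

δ-cong : ∀ {x y x′ y′} → (x ≡ y) ⇔ (x′ ≡ y′) → δ x y ≡ δ x′ y′
δ-cong {x} {y} {x′} {y′} x≡y⇔x′≡y′ with x ≟ y | x′ ≟ y′
... | yes _   | yes _    = refl
... | yes x≡y | no x′≢y′ = contradiction (Equivalence.to x≡y⇔x′≡y′ x≡y) x′≢y′
... | no x≢y  | yes x′≡y′ = contradiction (Equivalence.from x≡y⇔x′≡y′ x′≡y′) x≢y
... | no _    | no _     = refl

range-< : ∀ {b} i L → i + L ≤ b → All (_< b) (range i L)
range-< i zero    _         = []
range-< {b} i (suc L) i+1+L≤b = ≤-trans (s≤s (m≤m+n i L)) 1+i+L≤b ∷ range-< (suc i) L 1+i+L≤b
  where
  1+i+L≤b : suc i + L ≤ b
  1+i+L≤b = subst (_≤ b) (+-suc i L) i+1+L≤b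

rangeFromTo-< : ∀ i ν → i ≤ suc ν → All (_< suc ν) (rangeFromTo i ν)
rangeFromTo-< i ν i≤1+ν = range-< i (suc ν ∸ i) (≤-reflexive (m+[n∸m]≡n i≤1+ν))

downTo1-< : ∀ {b} i → i < b → All (_< b) (downTo1 i)
downTo1-< zero    _     = []
downTo1-< (suc i) 1+i<b = 1+i<b ∷ downTo1-< i (<-trans (n<1+n i) 1+i<b)

blockGens-< : ∀ μ a ν → ∣ μ ∣ ≤ ν → All (_< suc ν) (blockGens (μ , a , ν))
blockGens-< (+ zero)  a ν _   = ++⁺ (replicate⁺ a (s≤s z≤n)) (rangeFromTo-< 1 ν (s≤s z≤n))
blockGens-< (+ suc i) a ν i≤ν = rangeFromTo-< (suc i) ν (m≤n⇒m≤1+n i≤ν)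
blockGens-< -[1+ i ]  a ν i<ν =
  ++⁺ (downTo1-< (suc i) (s≤s i<ν)) (++⁺ (replicate⁺ a (s≤s z≤n)) (rangeFromTo-< 1 ν (s≤s z≤n)))

wordGens-< : ∀ {m b} W → CanonicalForm m b W → All (_< b) (wordGens W)
wordGens-< []                 _                     = []
wordGens-< ((μ , a , ν) ∷ W) (ν<b , μ≤ν , _ , _ , c) =
  ++⁺ (All.map (λ k<1+ν → ≤-trans k<1+ν ν<b) (blockGens-< μ a ν μ≤ν))
      (All.map (λ k<ν → <-trans k<ν ν<b) (wordGens-< W c))

CanonicalForm-eraseExp : ∀ {m b} W → CanonicalForm m b W → CanonicalForm 2 b (map eraseExp W)
CanonicalForm-eraseExp []                 _                     = tt
CanonicalForm-eraseExp ((μ , a , ν) ∷ W) (ν<b , μ≤ν , _ , _ , c) =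
  ν<b , μ≤ν , ≤-refl , s≤s (s≤s z≤n) , CanonicalForm-eraseExp W c

s₀-count : Block → ℕ
s₀-count (+ zero  , a , _) = a
s₀-count (+ suc _ , _ , _) = 0
s₀-count (-[1+ _ ] , a , _) = a

s₀-count-≤ : ∀ μ a ν → s₀-count (μ , a , ν) ≤ a
s₀-count-≤ (+ zero)  a ν = ≤-refl
s₀-count-≤ (+ suc _) a ν = z≤n
s₀-count-≤ -[1+ _ ]  a ν = ≤-refl

s₀-count-eraseExp : ∀ μ a ν → 1 ≤ a →
  s₀-count (eraseExp (μ , a , ν)) ≡ 1 ⊓ s₀-count (μ , a , ν)
s₀-count-eraseExp (+ zero)  (suc _) ν _ = refl
s₀-count-eraseExp (+ suc _) a       ν _ = refl
s₀-count-eraseExp -[1+ _ ]  (suc _) ν _ = refl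

blockExp : Block → ℕ → ℕ
blockExp (μ , a , ν) x = δ x ν * s₀-count (μ , a , ν)

blockExp-≢ : ∀ μ a ν x → x ≢ ν → blockExp (μ , a , ν) x ≡ 0
blockExp-≢ μ a ν x x≢ν = cong (_* s₀-count (μ , a , ν)) (δ-≢ x≢ν)

colExp : List Block → ℕ → ℕ
colExp []      x = 0
colExp (b ∷ W) x = blockExp b x + colExp W x

colExp-above : ∀ {m b} W x → CanonicalForm m b W → b ≤ x → colExp W x ≡ 0
colExp-above []                 x _                     _   = refl
colExp-above ((μ , a , ν) ∷ W) x (ν<b , _ , _ , _ , c) b≤x =
  cong₂ _+_ (blockExp-≢ μ a ν x (>⇒≢ ν<x)) (colExp-above W x c (<⇒≤ ν<x))
  where
  ν<x = <-≤-trans ν<b b≤x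

colExp-head : ∀ {m b} μ a ν W → CanonicalForm m b ((μ , a , ν) ∷ W) →
  colExp ((μ , a , ν) ∷ W) ν ≡ s₀-count (μ , a , ν)
colExp-head μ a ν W (_ , _ , _ , _ , c) = begin
  δ ν ν * s₀-count (μ , a , ν) + colExp W ν
    ≡⟨ cong₂ (λ d e → d * s₀-count (μ , a , ν) + e) (δ-refl ν) (colExp-above W ν c ≤-refl) ⟩
  1 * s₀-count (μ , a , ν) + 0
    ≡⟨ trans (+-identityʳ _) (*-identityˡ _) ⟩
  s₀-count (μ , a , ν)
    ∎

colExp-tail : ∀ μ a ν W x → x ≢ ν → colExp ((μ , a , ν) ∷ W) x ≡ colExp W x
colExp-tail μ a ν W x x≢ν = cong (_+ colExp W x) (blockExp-≢ μ a ν x x≢ν)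

colExp-< : ∀ {m b} .{{_ : NonZero m}} W x → CanonicalForm m b W → colExp W x < m
colExp-< {m} [] x _ = >-nonZero⁻¹ m
colExp-< {m} ((μ , a , ν) ∷ W) x c@(_ , _ , _ , a<m , c′) = case x ≟ ν of λ where
  (yes refl) → subst (_< m) (sym (colExp-head μ a ν W c)) (≤-<-trans (s₀-count-≤ μ a ν) a<m)
  (no x≢ν)   → subst (_< m) (sym (colExp-tail μ a ν W x x≢ν)) (colExp-< W x c′)

colExp-eraseExp : ∀ {m b} W x → CanonicalForm m b W → colExp (map eraseExp W) x ≡ 1 ⊓ colExp W x
colExp-eraseExp [] x _ = refl
colExp-eraseExp ((μ , a , ν) ∷ W) x c@(_ , _ , 1≤a , _ , c′) = case x ≟ ν of λ where
  (yes refl) → begin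
    colExp (map eraseExp ((μ , a , ν) ∷ W)) ν
      ≡⟨ colExp-head μ 1 ν _ (CanonicalForm-eraseExp ((μ , a , ν) ∷ W) c) ⟩
    s₀-count (μ , 1 , ν)                      ≡⟨ s₀-count-eraseExp μ a ν 1≤a ⟩
    1 ⊓ s₀-count (μ , a , ν)                  ≡⟨ cong (1 ⊓_) (colExp-head μ a ν W c) ⟨
    1 ⊓ colExp ((μ , a , ν) ∷ W) ν            ∎
  (no x≢ν) → begin
    colExp (map eraseExp ((μ , a , ν) ∷ W)) x ≡⟨ colExp-tail μ 1 ν (map eraseExp W) x x≢ν ⟩
    colExp (map eraseExp W) x                 ≡⟨ colExp-eraseExp W x c′ ⟩
    1 ⊓ colExp W x                            ≡⟨ cong (1 ⊓_) (colExp-tail μ a ν W x x≢ν) ⟨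
    1 ⊓ colExp ((μ , a , ν) ∷ W) x            ∎

module _ {n : ℕ} where

  transp-fix : ∀ {j b} (i : Fin n) → suc j < b → b ≤ toℕ i → transp n (suc j) i ≡ i
  transp-fix {j} i 1+j<b b≤i with toℕ i ≟ j
  ... | yes i≡j = contradiction (sym i≡j) (<⇒≢ (<-trans (n<1+n j) 1+j<i))
    where 1+j<i = <-≤-trans 1+j<b b≤i
  ... | no _ with toℕ i ≟ suc j
  ...   | yes i≡1+j = contradiction (sym i≡1+j) (<⇒≢ (<-≤-trans 1+j<b b≤i))
  ...   | no _ = refl

  transp-< : ∀ {j b} (i : Fin n) → suc j < b → toℕ i < b → toℕ (transp n (suc j) i) < b
  transp-< {j} i 1+j<b i<b with toℕ i ≟ j
  ... | yes i≡j with suc (toℕ i) <? n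
  ...   | yes 1+i<n = subst (_< _) (sym (trans (toℕ-fromℕ< 1+i<n) (cong suc i≡j))) 1+j<b
  ...   | no _ = i<b
  transp-< {j} i 1+j<b i<b | no _ with toℕ i ≟ suc j
  ...   | yes _ = ≤-<-trans (≤-trans (≤-reflexive (toℕ-pred i)) (m∸n≤m (toℕ i) 1)) i<b
  ...   | no _ = i<b

  transp-to-pred⇔ : ∀ {j} (x : Fin n) → suc j < n →
    (toℕ (transp n (suc j) x) ≡ j) ⇔ (toℕ x ≡ suc j)
  transp-to-pred⇔ {j} x 1+j<n = mk⇔ to from
    where
    to : toℕ (transp n (suc j) x) ≡ j → toℕ x ≡ suc j
    to hit with toℕ x ≟ j
    ... | yes x≡j with suc (toℕ x) <? n
    ...   | yes 1+x<n =
      contradiction (trans (cong suc (sym x≡j)) (trans (sym (toℕ-fromℕ< 1+x<n)) hit)) 1+n≢n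
    ...   | no 1+x≮n = contradiction (subst (λ t → suc t < n) (sym x≡j) 1+j<n) 1+x≮n
    to hit | no x≢j with toℕ x ≟ suc j
    ...   | yes x≡1+j = x≡1+j
    ...   | no _ = contradiction hit x≢j
    from : toℕ x ≡ suc j → toℕ (transp n (suc j) x) ≡ j
    from x≡1+j with toℕ x ≟ j
    ... | yes x≡j = contradiction (trans (sym x≡1+j) x≡j) 1+n≢n
    ... | no _ with toℕ x ≟ suc j
    ...   | yes _ = trans (toℕ-pred x) (cong (_∸ 1) x≡1+j)
    ...   | no x≢1+j = contradiction x≡1+j x≢1+j

  genPerm : ℕ → Fin n → Fin n
  genPerm zero    i = i
  genPerm (suc j) i = transp n (suc j) i

  genExp : ℕ → Fin n → ℕ
  genExp zero    i = δ (toℕ i) 0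
  genExp (suc _) i = 0

  wordPerm : List ℕ → Fin n → Fin n
  wordPerm []       i = i
  wordPerm (k ∷ ks) i = genPerm k (wordPerm ks i)

  wordExp : List ℕ → Fin n → ℕ
  wordExp []       i = 0
  wordExp (k ∷ ks) i = genExp k (wordPerm ks i) + wordExp ks i

  wordPerm-++ : ∀ xs ys i → wordPerm (xs ++ ys) i ≡ wordPerm xs (wordPerm ys i)
  wordPerm-++ []       ys i = refl
  wordPerm-++ (k ∷ xs) ys i = cong (genPerm k) (wordPerm-++ xs ys i)

  wordExp-++ : ∀ xs ys i → wordExp (xs ++ ys) i ≡ wordExp xs (wordPerm ys i) + wordExp ys i
  wordExp-++ []       ys i = refl
  wordExp-++ (k ∷ xs) ys i rewrite wordPerm-++ xs ys i | wordExp-++ xs ys i =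
    sym (+-assoc (genExp k (wordPerm xs (wordPerm ys i))) _ _)

  module _ (m : ℕ) .{{_ : NonZero m}} where

    toℕ-lookup-tabulate : ∀ {h : Fin n → ℕ} (f : Fin n → Fin m) → (∀ y → toℕ (f y) ≡ h y) →
      ∀ x → toℕ (lookup (tabulate f) x) ≡ h x
    toℕ-lookup-tabulate f f≗h x = trans (cong toℕ (lookup∘tabulate f x)) (f≗h x)

    lookup-perm-gen : ∀ k x → lookup (perm (gen m n k)) x ≡ genPerm k x
    lookup-perm-gen zero    x = lookup∘tabulate _ x
    lookup-perm-gen (suc j) x = lookup∘tabulate _ x

    toℕ-expo-gen : ∀ k x → toℕ (lookup (expo (gen m n k)) x) ≡ genExp k x % m
    toℕ-expo-gen zero    x = toℕ-lookup-tabulate {h = λ y → genExp 0 y % m} _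
      (λ { Fin.zero → toℕ-mod 1 m ; (Fin.suc _) → toℕ-mod 0 m }) x
    toℕ-expo-gen (suc j) x = toℕ-lookup-tabulate _ (λ _ → toℕ-mod 0 m) x

    lookup-perm-evalGens : ∀ ks i → lookup (perm (evalGens m n ks)) i ≡ wordPerm ks i
    lookup-perm-evalGens []       i = lookup∘tabulate _ i
    lookup-perm-evalGens (k ∷ ks) i =
      trans (lookup∘tabulate _ i)
            (trans (lookup-perm-gen k _) (cong (genPerm k) (lookup-perm-evalGens ks i)))

    toℕ-expo-evalGens : ∀ ks i → toℕ (lookup (expo (evalGens m n ks)) i) ≡ wordExp ks i % m
    toℕ-expo-evalGens []       i = toℕ-lookup-tabulate _ (λ _ → toℕ-mod 0 m) i
    toℕ-expo-evalGens (k ∷ ks) i = begin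
      toℕ (lookup (expo (evalGens m n (k ∷ ks))) i)
        ≡⟨ trans (cong toℕ (lookup∘tabulate _ i)) (toℕ-mod _ m) ⟩
      (toℕ (lookup (expo (gen m n k)) (lookup (perm g) i)) + toℕ (lookup (expo g) i)) % m
        ≡⟨ cong₂ (λ a b → (a + b) % m) genPart (toℕ-expo-evalGens ks i) ⟩
      (genExp k (wordPerm ks i) % m + wordExp ks i % m) % m
        ≡⟨ sym (%-distribˡ-+ (genExp k (wordPerm ks i)) (wordExp ks i) m) ⟩
      wordExp (k ∷ ks) i % m ∎
      where
      g = evalGens m n ks
      genPart : toℕ (lookup (expo (gen m n k)) (lookup (perm g) i)) ≡ genExp k (wordPerm ks i) % m
      genPart = trans (toℕ-expo-gen k _) (cong (λ y → genExp k y % m) (lookup-perm-evalGens ks i))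

  wordPerm-fix : ∀ {b} ks (i : Fin n) → All (_< b) ks → b ≤ toℕ i → wordPerm ks i ≡ i
  wordPerm-fix []            i []            b≤i = refl
  wordPerm-fix (zero ∷ ks)   i (_ ∷ ks<b)    b≤i = wordPerm-fix ks i ks<b b≤i
  wordPerm-fix (suc j ∷ ks)  i (1+j<b ∷ ks<b) b≤i
    rewrite wordPerm-fix ks i ks<b b≤i = transp-fix i 1+j<b b≤i

  wordPerm-< : ∀ {b} ks (i : Fin n) → All (_< b) ks → toℕ i < b → toℕ (wordPerm ks i) < b
  wordPerm-< []           i []             i<b = i<b
  wordPerm-< (zero ∷ ks)  i (_ ∷ ks<b)     i<b = wordPerm-< ks i ks<b i<b
  wordPerm-< (suc j ∷ ks) i (1+j<b ∷ ks<b) i<b = transp-< _ 1+j<b (wordPerm-< ks i ks<b i<b)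

  wordPerm-range≡⇔ : ∀ k L (x : Fin n) → k + L < n →
    (toℕ (wordPerm (range (suc k) L) x) ≡ k) ⇔ (toℕ x ≡ k + L)
  wordPerm-range≡⇔ k zero    x _ =
    subst (λ t → (toℕ x ≡ k) ⇔ (toℕ x ≡ t)) (sym (+-identityʳ k)) ⇔-refl
  wordPerm-range≡⇔ k (suc L) x k+1+L<n =
    ⇔-trans (transp-to-pred⇔ y (≤-<-trans (m≤m+n (suc k) L) 1+k+L<n))
            (subst (λ t → (toℕ y ≡ suc k) ⇔ (toℕ x ≡ t)) (sym (+-suc k L))
                   (wordPerm-range≡⇔ (suc k) L x 1+k+L<n))
    where
    y = wordPerm (range (suc (suc k)) L) x
    1+k+L<n : suc k + L < n
    1+k+L<n = subst (_< n) (+-suc k L) k+1+L<n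

  wordPerm-replicate : ∀ a (x : Fin n) → wordPerm (replicate a 0) x ≡ x
  wordPerm-replicate zero    x = refl
  wordPerm-replicate (suc a) x = wordPerm-replicate a x

  wordExp-replicate : ∀ a (y : Fin n) → wordExp (replicate a 0) y ≡ a * genExp 0 y
  wordExp-replicate zero    y = refl
  wordExp-replicate (suc a) y =
    cong₂ _+_ (cong (genExp 0) (wordPerm-replicate a y)) (wordExp-replicate a y)

  wordExp-range : ∀ k L (x : Fin n) → wordExp (range (suc k) L) x ≡ 0
  wordExp-range k zero    x = refl
  wordExp-range k (suc L) x = wordExp-range (suc k) L x

  wordExp-downTo1 : ∀ i (x : Fin n) → wordExp (downTo1 i) x ≡ 0
  wordExp-downTo1 zero    x = refl
  wordExp-downTo1 (suc i) x = wordExp-downTo1 i x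

  wordPerm-s₀-power : ∀ a ys (x : Fin n) → wordPerm (replicate a 0 ++ ys) x ≡ wordPerm ys x
  wordPerm-s₀-power a ys x = trans (wordPerm-++ (replicate a 0) ys x) (wordPerm-replicate a _)

  wordPerm-s₀-power-irrelevant : ∀ a a′ ys (x : Fin n) →
    wordPerm (replicate a 0 ++ ys) x ≡ wordPerm (replicate a′ 0 ++ ys) x
  wordPerm-s₀-power-irrelevant a a′ ys x =
    trans (wordPerm-s₀-power a ys x) (sym (wordPerm-s₀-power a′ ys x))

  wordPerm-blockGens-eraseExp : ∀ b (x : Fin n) →
    wordPerm (blockGens (eraseExp b)) x ≡ wordPerm (blockGens b) x
  wordPerm-blockGens-eraseExp (+ zero   , a , ν) x = wordPerm-s₀-power-irrelevant 1 a _ x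
  wordPerm-blockGens-eraseExp (+ suc _  , a , ν) x = refl
  wordPerm-blockGens-eraseExp (-[1+ i ] , a , ν) x = begin
    wordPerm (D ++ replicate 1 0 ++ R) x
      ≡⟨ wordPerm-++ D _ x ⟩
    wordPerm D (wordPerm (replicate 1 0 ++ R) x)
      ≡⟨ cong (wordPerm D) (wordPerm-s₀-power-irrelevant 1 a R x) ⟩
    wordPerm D (wordPerm (replicate a 0 ++ R) x)
      ≡⟨ wordPerm-++ D _ x ⟨
    wordPerm (D ++ replicate a 0 ++ R) x
      ∎
    where
    D = downTo1 (suc i)
    R = rangeFromTo 1 ν

  wordPerm-wordGens-eraseExp : ∀ W (x : Fin n) →
    wordPerm (wordGens (map eraseExp W)) x ≡ wordPerm (wordGens W) x
  wordPerm-wordGens-eraseExp []      x = refl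
  wordPerm-wordGens-eraseExp (b ∷ W) x = begin
    wordPerm (blockGens (eraseExp b) ++ wordGens (map eraseExp W)) x
      ≡⟨ wordPerm-++ (blockGens (eraseExp b)) _ x ⟩
    wordPerm (blockGens (eraseExp b)) (wordPerm (wordGens (map eraseExp W)) x)
      ≡⟨ cong (wordPerm (blockGens (eraseExp b))) (wordPerm-wordGens-eraseExp W x) ⟩
    wordPerm (blockGens (eraseExp b)) (wordPerm (wordGens W) x)
      ≡⟨ wordPerm-blockGens-eraseExp b _ ⟩
    wordPerm (blockGens b) (wordPerm (wordGens W) x)
      ≡⟨ wordPerm-++ (blockGens b) _ x ⟨
    wordPerm (blockGens b ++ wordGens W) x
      ∎

  wordExp-s₀-power-cycle : ∀ a ν (x : Fin n) → ν < n →
    wordExp (replicate a 0 ++ rangeFromTo 1 ν) x ≡ δ (toℕ x) ν * a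
  wordExp-s₀-power-cycle a ν x ν<n = begin
    wordExp (replicate a 0 ++ R) x
      ≡⟨ wordExp-++ (replicate a 0) R x ⟩
    wordExp (replicate a 0) (wordPerm R x) + wordExp R x
      ≡⟨ cong₂ _+_ (wordExp-replicate a (wordPerm R x)) (wordExp-range 0 ν x) ⟩
    a * δ (toℕ (wordPerm R x)) 0 + 0
      ≡⟨ trans (+-identityʳ _) (*-comm a _) ⟩
    δ (toℕ (wordPerm R x)) 0 * a
      ≡⟨ cong (_* a) (δ-cong (wordPerm-range≡⇔ 0 ν x ν<n)) ⟩
    δ (toℕ x) ν * a
      ∎
    where
    R = rangeFromTo 1 ν

  wordExp-blockGens : ∀ μ a ν (x : Fin n) → ν < n →
    wordExp (blockGens (μ , a , ν)) x ≡ blockExp (μ , a , ν) (toℕ x)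
  wordExp-blockGens (+ zero)  a ν x ν<n = wordExp-s₀-power-cycle a ν x ν<n
  wordExp-blockGens (+ suc i) a ν x ν<n = trans (wordExp-range i (ν ∸ i) x) (sym (*-zeroʳ (δ (toℕ x) ν)))
  wordExp-blockGens -[1+ i ]  a ν x ν<n =
    trans (wordExp-++ (downTo1 (suc i)) _ x)
          (cong₂ _+_ (wordExp-downTo1 (suc i) _) (wordExp-s₀-power-cycle a ν x ν<n))

  δ-wordPerm : ∀ {ν} ks (x : Fin n) → All (_< ν) ks → δ (toℕ (wordPerm ks x)) ν ≡ δ (toℕ x) ν
  δ-wordPerm {ν} ks x ks<ν with toℕ x <? ν
  ... | yes x<ν = trans (δ-≢ (<⇒≢ (wordPerm-< ks x ks<ν x<ν))) (sym (δ-≢ (<⇒≢ x<ν)))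
  ... | no x≮ν  = cong (λ y → δ (toℕ y) ν) (wordPerm-fix ks x ks<ν (≮⇒≥ x≮ν))

  wordExp-wordGens : ∀ {m b} W → CanonicalForm m b W → b ≤ n → (x : Fin n) →
    wordExp (wordGens W) x ≡ colExp W (toℕ x)
  wordExp-wordGens []                 _                       _   x = refl
  wordExp-wordGens ((μ , a , ν) ∷ W) (ν<b , _ , _ , _ , c) b≤n x = begin
    wordExp (Bg ++ Wg) x
      ≡⟨ wordExp-++ Bg Wg x ⟩
    wordExp Bg (wordPerm Wg x) + wordExp Wg x
      ≡⟨ cong₂ _+_ (wordExp-blockGens μ a ν _ ν<n) (wordExp-wordGens W c (<⇒≤ ν<n) x) ⟩
    blockExp (μ , a , ν) (toℕ (wordPerm Wg x)) + colExp W (toℕ x)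
      ≡⟨ cong (λ d → d * s₀-count (μ , a , ν) + _) (δ-wordPerm Wg x (wordGens-< W c)) ⟩
    colExp ((μ , a , ν) ∷ W) (toℕ x)
      ∎
    where
    Bg = blockGens (μ , a , ν)
    Wg = wordGens W
    ν<n = <-≤-trans ν<b b≤n

  toℕ-expo-evalWord : ∀ m .{{_ : NonZero m}} W → CanonicalForm m n W → (i : Fin n) →
    toℕ (lookup (expo (evalWord m n W)) i) ≡ colExp W (toℕ i)
  toℕ-expo-evalWord m W c i = begin
    toℕ (lookup (expo (evalWord m n W)) i) ≡⟨ toℕ-expo-evalGens m (wordGens W) i ⟩
    wordExp (wordGens W) i % m             ≡⟨ cong (_% m) (wordExp-wordGens W c ≤-refl i) ⟩
    colExp W (toℕ i) % m                   ≡⟨ m<n⇒m%n≡m (colExp-< W (toℕ i) c) ⟩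
    colExp W (toℕ i)                       ∎

-- The entry map of π is local to its definition; π of a 1 × 1 matrix exposes it.
π-entry : ∀ {m} → Fin m → Fin 2
π-entry z = lookup (expo (π ⟦ Vec.[ Fin.zero ] ⨾ Vec.[ z ] ⟧)) Fin.zero

toℕ-π-entry : ∀ {m} (z : Fin m) → toℕ (π-entry z) ≡ 1 ⊓ toℕ z
toℕ-π-entry Fin.zero    = refl
toℕ-π-entry (Fin.suc _) = refl

toℕ-expo-π : ∀ {m n} (g : Mon m n) i → toℕ (lookup (expo (π g)) i) ≡ 1 ⊓ toℕ (lookup (expo g) i)
toℕ-expo-π g i = trans (cong toℕ (lookup∘tabulate _ i)) (toℕ-π-entry (lookup (expo g) i))

evalWord-eraseExp : ∀ m n .{{_ : NonZero m}} W → CanonicalForm m n W →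
  evalWord 2 n (map eraseExp W) ≡ π (evalWord m n W)
evalWord-eraseExp m n W c =
  cong₂ ⟦_⨾_⟧ (lookup-extensionality samePerm)
              (lookup-extensionality (λ i → toℕ-injective (sameExpo i)))
  where
  W′ = map eraseExp W
  samePerm : ∀ i → lookup (perm (evalWord 2 n W′)) i ≡ lookup (perm (evalWord m n W)) i
  samePerm i = begin
    lookup (perm (evalWord 2 n W′)) i ≡⟨ lookup-perm-evalGens 2 (wordGens W′) i ⟩
    wordPerm (wordGens W′) i          ≡⟨ wordPerm-wordGens-eraseExp W i ⟩
    wordPerm (wordGens W) i           ≡⟨ lookup-perm-evalGens m (wordGens W) i ⟨
    lookup (perm (evalWord m n W)) i  ∎
  sameExpo : ∀ i →
    toℕ (lookup (expo (evalWord 2 n W′)) i) ≡ toℕ (lookup (expo (π (evalWord m n W))) i)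
  sameExpo i = begin
    toℕ (lookup (expo (evalWord 2 n W′)) i)    ≡⟨ toℕ-expo-evalWord 2 W′ (CanonicalForm-eraseExp W c) i ⟩
    colExp W′ (toℕ i)                          ≡⟨ colExp-eraseExp W (toℕ i) c ⟩
    1 ⊓ colExp W (toℕ i)                       ≡⟨ cong (1 ⊓_) (toℕ-expo-evalWord m W c i) ⟨
    1 ⊓ toℕ (lookup (expo (evalWord m n W)) i) ≡⟨ toℕ-expo-π (evalWord m n W) i ⟨
    toℕ (lookup (expo (π (evalWord m n W))) i) ∎

proposition3p4 : (m n : ℕ) .{{_ : NonZero m}} → 1 ≤ n →
    (g : Mon m n) (W : List Block) →
    IsCanonicalWordOf m n W g →
    IsCanonicalWordOf 2 n (map eraseExp W) (π g)
proposition3p4 m n _ g W (c , refl) = CanonicalForm-eraseExp W c , evalWord-eraseExp m n W c
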